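{- For all $\ell\ge1$ and all words $u,w\in A^*$, $$\binom{\varphi^\ell(w)}{u}=\sum_{i=0}^{\ell-1}\sum_{v\in f^i(u)} m_{f^i(u)}(v)\binom{|\varphi^{\ell-i-1}(w)|}{|v|}+\sum_{x\in f^\ell(u)} m_{f^\ell(u)}(x)\binom{w}{x}.$$
   Context: $A=\{0,1\}$, $\varphi(0)=01$, $\varphi(1)=10$. $\binom{u}{x}$ is the number of occurrences of $x$ as a subword (subsequence) of $u$; for integers, $\binom{N}{r}$ is the usual binomial coefficient. A $\varphi$-factorization of $u$ is a factorization $u=w_0\varphi(a_1)w_1\cdots\varphi(a_k)w_k$ with $k\ge1$, $a_i\in A$, $w_i\in A^*$, identified with its tuple of positions $(|w_0|,|w_0\varphi(a_1)w_1|,\ldots)$; for such $\kappa$, $\mathcal{L}(u,\kappa)=A^{|w_0|}a_1A^{|w_1|}\cdots a_kA^{|w_k|}$ (multiplicities $1$). $f(u)$ is the multiset sum of $\mathcal{L}(u,\kappa)$ over all $\varphi$-factorizations ($f(u)=\emptyset$ if $u\in0^*\cup1^*$); for a multiset $M$, $f(M)$ is the multiset sum of $f(v)$ over $v\in M$ with multiplicity; $f^0(u)=\{u\}$ with multiplicity one, $f^{i+1}=f\circ f^i$. $m_M(v)$ is the multiplicity of $v$ in $M$. -}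

module Defs where

open import Data.Bool using (Bool; true; false; not; if_then_else_; _∧_; _∨_)
open import Data.Bool.Properties renaming (_≟_ to _≟𝔹_)
open import Data.Nat using (ℕ; zero; suc; _+_; _*_)
open import Data.Maybe using (Maybe; just; nothing)
open import Data.List using (List; []; _∷_; _++_; map; concatMap; filter; length; deduplicate; upTo)
open import Data.Nat.ListAction using (sum)
open import Data.Nat.Combinatorics using (_C_)
open import Data.List.Properties using (≡-dec)
open import Relation.Nullary using (does)
open import Relation.Binary.PropositionalEquality using (_≡_)
open import Relation.Binary.Definitions using (DecidableEquality)

-- Alphabet A = {0,1} is encoded as Bool with 0 = false, 1 = true.
Word : Set
Word = List Bool

-- A finite multiset of words is represented by a list (order irrelevant,
-- repetitions = multiplicities).
Multiset : Set
Multiset = List Word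

_≟w_ : DecidableEquality Word
_≟w_ = ≡-dec _≟𝔹_

φ : Word → Word
φ [] = []
φ (a ∷ w) = a ∷ not a ∷ φ w

φ^ : ℕ → Word → Word
φ^ zero w = w
φ^ (suc n) w = φ (φ^ n w)

binomW : Word → Word → ℕ
binomW u [] = 1
binomW [] (b ∷ x) = 0
binomW (a ∷ u) (b ∷ x) =
  (if does (a ≟𝔹 b) then binomW u x else 0) + binomW u (b ∷ x)

binomN : ℕ → ℕ → ℕ
binomN n k = n C k

-- A φ-factorization u = w₀ φ(a₁) w₁ ⋯ φ(a_k) w_k (k ≥ 0 here) is encoded
-- by a pattern: a list of Maybe Bool obtained from u by replacing each
-- letter of a wᵢ by `nothing` and each block φ(aᵢ) by the single entry
-- `just aᵢ`.  The pattern is exactly the "shape" of L(u,κ).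
-- `factorizations u` enumerates all factorizations (with k ≥ 0), each
-- exactly once (distinct position tuples give distinct patterns-in-order
-- of enumeration).
factorizations : Word → List (List (Maybe Bool))
factorizations [] = [] ∷ []
factorizations (a ∷ []) = (nothing ∷ []) ∷ []
factorizations (a ∷ b ∷ u) =
  map (nothing ∷_) (factorizations (b ∷ u))
  ++ (if does (a ≟𝔹 b) then [] else map (just a ∷_) (factorizations u))

hasBlock : List (Maybe Bool) → Bool
hasBlock [] = false
hasBlock (nothing ∷ p) = hasBlock p
hasBlock (just _ ∷ p) = true

language : List (Maybe Bool) → List Word
language [] = [] ∷ []
language (nothing ∷ p) = concatMap (λ v → (false ∷ v) ∷ (true ∷ v) ∷ []) (language p)
language (just a ∷ p) = map (a ∷_) (language p)

f : Word → Multiset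
f u = concatMap language (filter (λ p → Data.Bool.T? (hasBlock p)) (factorizations u))
  where import Data.Bool

fM : Multiset → Multiset
fM = concatMap f

f^ : ℕ → Word → Multiset
f^ zero u = u ∷ []
f^ (suc i) u = fM (f^ i u)

mult : Multiset → Word → ℕ
mult M v = length (filter (λ x → x ≟w v) M)

Σ∈ : Multiset → (Word → ℕ) → ℕ
Σ∈ M g = sum (map (λ v → mult M v * g v) (deduplicate _≟w_ M))

Σ< : ℕ → (ℕ → ℕ) → ℕ
Σ< n g = sum (map g (upTo n))

module Submission where

-- Sort the letters of an occurrence of u in φ w by the block φ a = a (not a) of
-- φ w they come from.  A block supplies no letter, one letter (it contains each
-- letter exactly once, so any letter of u can be taken from it), or both letters,
-- which then form a factor φ a of u.  So binomW (φ w) u is the sum, over the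
-- φ-factorizations of u with k ≥ 0, of the number of occurrences in w of the
-- pattern in which a letter of some wᵢ matches any letter and a block φ aᵢ
-- matches aᵢ.  The block-free factorization gives |w| C |u|, the others give
-- Σ_{x ∈ f u} binomW w x.  Applying this identity to φ^ℓ w = φ (φ^(ℓ-1) w),
-- summed over the multiset f^i u at step i, yields the corollary.

open import Defs
open import Data.Nat using (ℕ; _+_; _∸_; _≤_)
open import Data.List using (length)
open import Relation.Binary.PropositionalEquality using (_≡_)

open import Data.Bool using (Bool; true; false; not; if_then_else_; T?)
open import Data.Bool.Properties using (if-float; if-eta; if-cong-else) renaming (_≟_ to _≟𝔹_)
open import Data.List using (List; []; _∷_; _++_; map; concatMap; filter; replicate; upTo)
open import Data.List.Membership.Propositional using (_∈_)
open import Data.List.Membership.Propositional.Properties using (∈-deduplicate⁺)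
open import Data.List.Properties using (map-++; map-applyUpTo; map-upTo)
open import Data.List.Relation.Unary.All as All using (All; []; _∷_)
open import Data.List.Relation.Unary.Any using (here; there)
open import Data.List.Relation.Unary.Unique.Propositional using (Unique; []; _∷_)
open import Data.List.Relation.Unary.Unique.DecPropositional.Properties using (deduplicate-!)
open import Data.Maybe using (Maybe; just; nothing)
open import Data.Nat using (zero; suc; _*_)
open import Data.Nat.Combinatorics using (_C_; nCk+nC[k+1]≡[n+1]C[k+1])
open import Data.Nat.GeneralisedArithmetic using (fold; iterate; iterate-is-fold)
open import Data.Nat.ListAction using (sum)
open import Data.Nat.ListAction.Properties using (sum-++)
open import Data.Nat.Properties using (+-assoc; +-identityʳ; +-commutativeSemigroup)
open import Algebra.Properties.CommutativeSemigroup +-commutativeSemigroup using (interchange; x∙yz≈y∙xz)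
open import Function using (_∘_)
open import Relation.Binary.Definitions using (DecidableEquality)
open import Relation.Binary.PropositionalEquality using (_≢_; refl; sym; trans; cong; cong₂; module ≡-Reasoning)
open import Relation.Nullary using (does; yes; no; contradiction)

∑ : {A : Set} → (A → ℕ) → List A → ℕ
∑ g xs = sum (map g xs)

module _ {A : Set} where

  ∑-++ : (g : A → ℕ) (xs ys : List A) → ∑ g (xs ++ ys) ≡ ∑ g xs + ∑ g ys
  ∑-++ g xs ys = trans (cong sum (map-++ g xs ys)) (sum-++ (map g xs) (map g ys))

  ∑-cong : {g h : A → ℕ} → (∀ x → g x ≡ h x) → (xs : List A) → ∑ g xs ≡ ∑ h xs
  ∑-cong g≗h [] = refl
  ∑-cong g≗h (x ∷ xs) = cong₂ _+_ (g≗h x) (∑-cong g≗h xs)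

  ∑-zero : (xs : List A) → ∑ (λ _ → 0) xs ≡ 0
  ∑-zero [] = refl
  ∑-zero (x ∷ xs) = ∑-zero xs

  ∑-+ : (g h : A → ℕ) (xs : List A) → ∑ (λ x → g x + h x) xs ≡ ∑ g xs + ∑ h xs
  ∑-+ g h [] = refl
  ∑-+ g h (x ∷ xs) = trans (cong (g x + h x +_) (∑-+ g h xs))
                           (interchange (g x) (h x) (∑ g xs) (∑ h xs))

  ∑-if : (b : Bool) (g : A → ℕ) (xs : List A) →
         ∑ (λ x → if b then g x else 0) xs ≡ (if b then ∑ g xs else 0)
  ∑-if true g xs = refl
  ∑-if false g xs = ∑-zero xs

  ∑-filter : (P : A → Bool) (g : A → ℕ) (xs : List A) →
             ∑ g (filter (λ x → T? (P x)) xs) ≡ ∑ (λ x → if P x then g x else 0) xs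
  ∑-filter P g [] = refl
  ∑-filter P g (x ∷ xs) with P x
  ... | true = cong (g x +_) (∑-filter P g xs)
  ... | false = ∑-filter P g xs

  ∑-split-if : (P : A → Bool) (g : A → ℕ) (xs : List A) →
               ∑ g xs ≡ ∑ (λ x → if P x then 0 else g x) xs + ∑ (λ x → if P x then g x else 0) xs
  ∑-split-if P g xs = trans (∑-cong split xs) (∑-+ _ _ xs)
    where
    split : ∀ x → g x ≡ (if P x then 0 else g x) + (if P x then g x else 0)
    split x with P x
    ... | true = refl
    ... | false = sym (+-identityʳ (g x))

module _ {A B : Set} where

  ∑-map : (g : B → ℕ) (h : A → B) (xs : List A) → ∑ g (map h xs) ≡ ∑ (g ∘ h) xs
  ∑-map g h [] = refl
  ∑-map g h (x ∷ xs) = cong (g (h x) +_) (∑-map g h xs)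

  ∑-concatMap : (g : B → ℕ) (h : A → List B) (xs : List A) →
                ∑ g (concatMap h xs) ≡ ∑ (∑ g ∘ h) xs
  ∑-concatMap g h [] = refl
  ∑-concatMap g h (x ∷ xs) =
    trans (∑-++ g (h x) (concatMap h xs)) (cong (∑ g (h x) +_) (∑-concatMap g h xs))

module _ {A : Set} (_≟_ : DecidableEquality A) where

  ∑-indicator-∉ : ∀ {x} (g : A → ℕ) {ys} → All (x ≢_) ys →
                  ∑ (λ v → if does (x ≟ v) then g v else 0) ys ≡ 0
  ∑-indicator-∉ g [] = refl
  ∑-indicator-∉ {x} g {y ∷ _} (x≢y ∷ x∉ys) with x ≟ y
  ... | yes x≡y = contradiction x≡y x≢y
  ... | no _ = ∑-indicator-∉ g x∉ys

  ∑-indicator-unique : ∀ {x} (g : A → ℕ) {ys} → Unique ys → x ∈ ys →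
                       ∑ (λ v → if does (x ≟ v) then g v else 0) ys ≡ g x
  ∑-indicator-unique {x} g (x∉ys ∷ _) (here refl) with x ≟ x
  ... | yes _ = trans (cong (g x +_) (∑-indicator-∉ g x∉ys)) (+-identityʳ (g x))
  ... | no x≢x = contradiction refl x≢x
  ∑-indicator-unique {x} g {y ∷ _} (y∉ys ∷ ys!) (there x∈ys) with x ≟ y
  ... | yes refl = contradiction refl (All.lookup y∉ys x∈ys)
  ... | no _ = ∑-indicator-unique g ys! x∈ys

  ∑-multiplicities : (g : A → ℕ) {ys : List A} → Unique ys → ∀ {xs} → All (_∈ ys) xs →
                     ∑ (λ v → length (filter (_≟ v) xs) * g v) ys ≡ ∑ g xs
  ∑-multiplicities g {ys} ys! [] = ∑-zero ys
  ∑-multiplicities g {ys} ys! {x ∷ xs} (x∈ys ∷ xs⊆ys) = begin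
      ∑ (λ v → length (filter (_≟ v) (x ∷ xs)) * g v) ys
    ≡⟨ ∑-cong multiplicity-∷ ys ⟩
      ∑ (λ v → (if does (x ≟ v) then g v else 0) + length (filter (_≟ v) xs) * g v) ys
    ≡⟨ ∑-+ _ _ ys ⟩
      ∑ (λ v → if does (x ≟ v) then g v else 0) ys + ∑ (λ v → length (filter (_≟ v) xs) * g v) ys
    ≡⟨ cong₂ _+_ (∑-indicator-unique g ys! x∈ys) (∑-multiplicities g ys! xs⊆ys) ⟩
      g x + ∑ g xs
    ∎
    where
    open ≡-Reasoning
    multiplicity-∷ : ∀ v → length (filter (_≟ v) (x ∷ xs)) * g v
                           ≡ (if does (x ≟ v) then g v else 0) + length (filter (_≟ v) xs) * g v
    multiplicity-∷ v with does (x ≟ v)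
    ... | true = refl
    ... | false = refl

Σ∈-∑ : (M : Multiset) (g : Word → ℕ) → Σ∈ M g ≡ ∑ g M
Σ∈-∑ M g = ∑-multiplicities _≟w_ g (deduplicate-! _≟w_ M) (All.tabulate (∈-deduplicate⁺ _≟w_))

Pattern : Set
Pattern = List (Maybe Bool)

binomP : Word → Pattern → ℕ
binomP w [] = 1
binomP [] (x ∷ p) = 0
binomP (c ∷ w) (nothing ∷ p) = binomP w p + binomP w (nothing ∷ p)
binomP (c ∷ w) (just a ∷ p) = (if does (c ≟𝔹 a) then binomP w p else 0) + binomP w (just a ∷ p)

binomP-wildcards : ∀ w n → binomP w (replicate n nothing) ≡ length w C n
binomP-wildcards w zero = refl
binomP-wildcards [] (suc n) = refl
binomP-wildcards (c ∷ w) (suc n) =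
  trans (cong₂ _+_ (binomP-wildcards w n) (binomP-wildcards w (suc n)))
        (nCk+nC[k+1]≡[n+1]C[k+1] (length w) n)

bothLetters : Word → List Word
bothLetters v = (false ∷ v) ∷ (true ∷ v) ∷ []

∑-binomW-bothLetters : ∀ c w v →
  ∑ (binomW (c ∷ w)) (bothLetters v) ≡ binomW w v + ∑ (binomW w) (bothLetters v)
∑-binomW-bothLetters false w v = +-assoc (binomW w v) _ _
∑-binomW-bothLetters true w v =
  trans (cong (binomW w (false ∷ v) +_) (+-assoc (binomW w v) _ 0))
        (x∙yz≈y∙xz (binomW w (false ∷ v)) (binomW w v) (binomW w (true ∷ v) + 0))

∑-binomW-language : ∀ w p → ∑ (binomW w) (language p) ≡ binomP w p
∑-binomW-language w [] = refl
∑-binomW-language [] (just a ∷ p) = trans (∑-map (binomW []) (a ∷_) (language p)) (∑-zero (language p))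
∑-binomW-language [] (nothing ∷ p) =
  trans (∑-concatMap (binomW []) bothLetters (language p)) (∑-zero (language p))
∑-binomW-language (c ∷ w) (just a ∷ p) = begin
    ∑ (binomW (c ∷ w)) (map (a ∷_) (language p))
  ≡⟨ ∑-map (binomW (c ∷ w)) (a ∷_) (language p) ⟩
    ∑ (λ v → (if does (c ≟𝔹 a) then binomW w v else 0) + binomW w (a ∷ v)) (language p)
  ≡⟨ ∑-+ _ _ (language p) ⟩
    ∑ (λ v → if does (c ≟𝔹 a) then binomW w v else 0) (language p) + ∑ (binomW w ∘ (a ∷_)) (language p)
  ≡⟨ cong₂ _+_ (∑-if (does (c ≟𝔹 a)) (binomW w) (language p))
               (sym (∑-map (binomW w) (a ∷_) (language p))) ⟩
    (if does (c ≟𝔹 a) then ∑ (binomW w) (language p) else 0) + ∑ (binomW w) (language (just a ∷ p))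
  ≡⟨ cong₂ _+_ (cong (λ n → if does (c ≟𝔹 a) then n else 0) (∑-binomW-language w p))
               (∑-binomW-language w (just a ∷ p)) ⟩
    binomP (c ∷ w) (just a ∷ p)
  ∎
  where open ≡-Reasoning
∑-binomW-language (c ∷ w) (nothing ∷ p) = begin
    ∑ (binomW (c ∷ w)) (concatMap bothLetters (language p))
  ≡⟨ ∑-concatMap (binomW (c ∷ w)) bothLetters (language p) ⟩
    ∑ (λ v → ∑ (binomW (c ∷ w)) (bothLetters v)) (language p)
  ≡⟨ ∑-cong (∑-binomW-bothLetters c w) (language p) ⟩
    ∑ (λ v → binomW w v + ∑ (binomW w) (bothLetters v)) (language p)
  ≡⟨ ∑-+ _ _ (language p) ⟩
    ∑ (binomW w) (language p) + ∑ (∑ (binomW w) ∘ bothLetters) (language p)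
  ≡⟨ cong (∑ (binomW w) (language p) +_) (sym (∑-concatMap (binomW w) bothLetters (language p))) ⟩
    ∑ (binomW w) (language p) + ∑ (binomW w) (language (nothing ∷ p))
  ≡⟨ cong₂ _+_ (∑-binomW-language w p) (∑-binomW-language w (nothing ∷ p)) ⟩
    binomP (c ∷ w) (nothing ∷ p)
  ∎
  where open ≡-Reasoning

∑-factorizations-∷∷ : (g : Pattern → ℕ) (a b : Bool) (u : Word) →
  ∑ g (factorizations (a ∷ b ∷ u))
    ≡ ∑ (g ∘ (nothing ∷_)) (factorizations (b ∷ u))
      + (if does (a ≟𝔹 b) then 0 else ∑ (g ∘ (just a ∷_)) (factorizations u))
∑-factorizations-∷∷ g a b u =
  trans (∑-++ g (map (nothing ∷_) (factorizations (b ∷ u))) _)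
        (cong₂ _+_ (∑-map g (nothing ∷_) (factorizations (b ∷ u)))
                   (trans (if-float (∑ g) (does (a ≟𝔹 b)))
                          (if-cong-else (does (a ≟𝔹 b)) (∑-map g (just a ∷_) (factorizations u)))))

∑-blockFree-factorizations : (g : Pattern → ℕ) (u : Word) →
  ∑ (λ p → if hasBlock p then 0 else g p) (factorizations u) ≡ g (replicate (length u) nothing)
∑-blockFree-factorizations g [] = +-identityʳ (g [])
∑-blockFree-factorizations g (a ∷ []) = +-identityʳ (g (nothing ∷ []))
∑-blockFree-factorizations g (a ∷ b ∷ u) =
  trans (∑-factorizations-∷∷ _ a b u)
        (trans (cong₂ _+_ (∑-blockFree-factorizations (g ∘ (nothing ∷_)) (b ∷ u))
                          (trans (if-cong-else (does (a ≟𝔹 b)) (∑-zero (factorizations u)))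
                                 (if-eta (does (a ≟𝔹 b)))))
               (+-identityʳ _))

∑-binomP-[] : (b : Bool) (u : Word) → ∑ (binomP []) (factorizations (b ∷ u)) ≡ 0
∑-binomP-[] b [] = refl
∑-binomP-[] b (c ∷ u) =
  trans (∑-factorizations-∷∷ (binomP []) b c u)
        (cong₂ _+_ (∑-zero (factorizations (c ∷ u)))
                   (trans (if-cong-else (does (b ≟𝔹 c)) (∑-zero (factorizations u)))
                          (if-eta (does (b ≟𝔹 c)))))

-- An occurrence of b c ⋯ in φ (a ∷ w) = a ∷ not a ∷ φ w can take both b and c
-- from the block a (not a) exactly when a ≡ b and b ≢ c.
blockCount : Bool → Bool → Bool → ℕ → ℕ
blockCount a b c n = if does (b ≟𝔹 c) then 0 else (if does (a ≟𝔹 b) then n else 0)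

binomW-φ-∷-singleton : ∀ a b w → binomW (φ (a ∷ w)) (b ∷ []) ≡ suc (binomW (φ w) (b ∷ []))
binomW-φ-∷-singleton false false w = refl
binomW-φ-∷-singleton false true w = refl
binomW-φ-∷-singleton true false w = refl
binomW-φ-∷-singleton true true w = refl

if-not-≟-+ : ∀ b c x y z →
  (if does (not b ≟𝔹 c) then x else 0) + y + z ≡ (if does (b ≟𝔹 c) then 0 else x) + (y + z)
if-not-≟-+ false false x y z = refl
if-not-≟-+ false true x y z = +-assoc x y z
if-not-≟-+ true false x y z = +-assoc x y z
if-not-≟-+ true true x y z = refl

binomW-φ-∷-∷ : ∀ a b c w u →
  binomW (φ (a ∷ w)) (b ∷ c ∷ u)
    ≡ blockCount a b c (binomW (φ w) u) + (binomW (φ w) (c ∷ u) + binomW (φ w) (b ∷ c ∷ u))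
binomW-φ-∷-∷ false false c w u = if-not-≟-+ false c _ _ _
binomW-φ-∷-∷ true true c w u = if-not-≟-+ true c _ _ _
binomW-φ-∷-∷ false true c w u =
  cong (_+ (binomW (φ w) (c ∷ u) + binomW (φ w) (true ∷ c ∷ u))) (sym (if-eta (does (true ≟𝔹 c))))
binomW-φ-∷-∷ true false c w u =
  cong (_+ (binomW (φ w) (c ∷ u) + binomW (φ w) (false ∷ c ∷ u))) (sym (if-eta (does (false ≟𝔹 c))))

∑-binomP-∷-∷ : ∀ a b c w u →
  ∑ (binomP (a ∷ w)) (factorizations (b ∷ c ∷ u))
    ≡ blockCount a b c (∑ (binomP w) (factorizations u))
      + (∑ (binomP w) (factorizations (c ∷ u)) + ∑ (binomP w) (factorizations (b ∷ c ∷ u)))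
∑-binomP-∷-∷ a b c w u = begin
    ∑ (binomP (a ∷ w)) (factorizations (b ∷ c ∷ u))
  ≡⟨ ∑-factorizations-∷∷ (binomP (a ∷ w)) b c u ⟩
    ∑ (λ p → binomP w p + binomP w (nothing ∷ p)) F₁
      + (if d then 0 else ∑ (λ p → (if e then binomP w p else 0) + binomP w (just b ∷ p)) F₂)
  ≡⟨ cong₂ (λ x y → x + (if d then 0 else y))
           (∑-+ (binomP w) (binomP w ∘ (nothing ∷_)) F₁)
           (trans (∑-+ _ (binomP w ∘ (just b ∷_)) F₂) (cong (_+ S₂) (∑-if e (binomP w) F₂))) ⟩
    (T₁ + S₁) + (if d then 0 else ((if e then T₂ else 0) + S₂))
  ≡⟨ cong ((T₁ + S₁) +_) (if-then-0-distrib d) ⟩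
    (T₁ + S₁) + (blockCount a b c T₂ + (if d then 0 else S₂))
  ≡⟨ x∙yz≈y∙xz (T₁ + S₁) (blockCount a b c T₂) _ ⟩
    blockCount a b c T₂ + ((T₁ + S₁) + (if d then 0 else S₂))
  ≡⟨ cong (blockCount a b c T₂ +_) (+-assoc T₁ S₁ _) ⟩
    blockCount a b c T₂ + (T₁ + (S₁ + (if d then 0 else S₂)))
  ≡⟨ cong (λ x → blockCount a b c T₂ + (T₁ + x)) (sym (∑-factorizations-∷∷ (binomP w) b c u)) ⟩
    blockCount a b c T₂ + (T₁ + ∑ (binomP w) (factorizations (b ∷ c ∷ u)))
  ∎
  where
  open ≡-Reasoning
  F₁ F₂ : List Pattern
  F₁ = factorizations (c ∷ u)
  F₂ = factorizations u
  d e : Bool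
  d = does (b ≟𝔹 c)
  e = does (a ≟𝔹 b)
  T₁ S₁ T₂ S₂ : ℕ
  T₁ = ∑ (binomP w) F₁
  S₁ = ∑ (binomP w ∘ (nothing ∷_)) F₁
  T₂ = ∑ (binomP w) F₂
  S₂ = ∑ (binomP w ∘ (just b ∷_)) F₂
  if-then-0-distrib : ∀ t {x y} → (if t then 0 else x + y) ≡ (if t then 0 else x) + (if t then 0 else y)
  if-then-0-distrib true = refl
  if-then-0-distrib false = refl

binomW-φ≡∑-binomP : ∀ w u → binomW (φ w) u ≡ ∑ (binomP w) (factorizations u)
binomW-φ≡∑-binomP [] [] = refl
binomW-φ≡∑-binomP [] (b ∷ u) = sym (∑-binomP-[] b u)
binomW-φ≡∑-binomP (a ∷ w) [] = refl
binomW-φ≡∑-binomP (a ∷ w) (b ∷ []) =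
  trans (binomW-φ-∷-singleton a b w) (cong suc (binomW-φ≡∑-binomP w (b ∷ [])))
binomW-φ≡∑-binomP (a ∷ w) (b ∷ c ∷ u) = begin
    binomW (φ (a ∷ w)) (b ∷ c ∷ u)
  ≡⟨ binomW-φ-∷-∷ a b c w u ⟩
    blockCount a b c (binomW (φ w) u) + (binomW (φ w) (c ∷ u) + binomW (φ w) (b ∷ c ∷ u))
  ≡⟨ cong₂ (λ x y → blockCount a b c x + y) (binomW-φ≡∑-binomP w u)
       (cong₂ _+_ (binomW-φ≡∑-binomP w (c ∷ u)) (binomW-φ≡∑-binomP w (b ∷ c ∷ u))) ⟩
    blockCount a b c (∑ (binomP w) (factorizations u))
      + (∑ (binomP w) (factorizations (c ∷ u)) + ∑ (binomP w) (factorizations (b ∷ c ∷ u)))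
  ≡⟨ sym (∑-binomP-∷-∷ a b c w u) ⟩
    ∑ (binomP (a ∷ w)) (factorizations (b ∷ c ∷ u))
  ∎
  where open ≡-Reasoning

binomW-φ : ∀ w u → binomW (φ w) u ≡ binomN (length w) (length u) + ∑ (binomW w) (f u)
binomW-φ w u = begin
    binomW (φ w) u
  ≡⟨ binomW-φ≡∑-binomP w u ⟩
    ∑ (binomP w) Fs
  ≡⟨ ∑-split-if hasBlock (binomP w) Fs ⟩
    ∑ (λ p → if hasBlock p then 0 else binomP w p) Fs + ∑ (λ p → if hasBlock p then binomP w p else 0) Fs
  ≡⟨ cong₂ _+_ (trans (∑-blockFree-factorizations (binomP w) u) (binomP-wildcards w (length u)))
               (sym (∑-filter hasBlock (binomP w) Fs)) ⟩
    length w C length u + ∑ (binomP w) withBlock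
  ≡⟨ cong (length w C length u +_)
          (sym (trans (∑-concatMap (binomW w) language withBlock) (∑-cong (∑-binomW-language w) withBlock))) ⟩
    binomN (length w) (length u) + ∑ (binomW w) (f u)
  ∎
  where
  open ≡-Reasoning
  Fs withBlock : List Pattern
  Fs = factorizations u
  withBlock = filter (λ p → T? (hasBlock p)) Fs

∑-binomW-φ : ∀ w M →
  ∑ (binomW (φ w)) M ≡ ∑ (λ v → binomN (length w) (length v)) M + ∑ (binomW w) (fM M)
∑-binomW-φ w M =
  trans (∑-cong (binomW-φ w) M)
        (trans (∑-+ _ _ M) (cong (∑ (λ v → binomN (length w) (length v)) M +_)
                                 (sym (∑-concatMap (binomW w) f M))))

Σ<-suc : ∀ n g → Σ< (suc n) g ≡ g 0 + Σ< n (g ∘ suc)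
Σ<-suc n g = cong (λ xs → g 0 + sum xs) (trans (map-applyUpTo suc g n) (sym (map-upTo (g ∘ suc) n)))

∑-binomW-φ^ : ∀ ℓ w M →
  ∑ (binomW (φ^ ℓ w)) M
    ≡ Σ< ℓ (λ i → ∑ (λ v → binomN (length (φ^ (ℓ ∸ i ∸ 1) w)) (length v)) (iterate fM M i))
      + ∑ (binomW w) (iterate fM M ℓ)
∑-binomW-φ^ zero w M = refl
∑-binomW-φ^ (suc ℓ) w M = begin
    ∑ (binomW (φ (φ^ ℓ w))) M
  ≡⟨ ∑-binomW-φ (φ^ ℓ w) M ⟩
    G 0 + ∑ (binomW (φ^ ℓ w)) (fM M)
  ≡⟨ cong (G 0 +_) (∑-binomW-φ^ ℓ w (fM M)) ⟩
    G 0 + (Σ< ℓ (G ∘ suc) + ∑ (binomW w) (iterate fM M (suc ℓ)))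
  ≡⟨ sym (+-assoc (G 0) _ _) ⟩
    G 0 + Σ< ℓ (G ∘ suc) + ∑ (binomW w) (iterate fM M (suc ℓ))
  ≡⟨ cong (_+ ∑ (binomW w) (iterate fM M (suc ℓ))) (sym (Σ<-suc ℓ G)) ⟩
    Σ< (suc ℓ) G + ∑ (binomW w) (iterate fM M (suc ℓ))
  ∎
  where
  open ≡-Reasoning
  G : ℕ → ℕ
  G i = ∑ (λ v → binomN (length (φ^ (suc ℓ ∸ i ∸ 1) w)) (length v)) (iterate fM M i)

f^≡iterate : ∀ i u → f^ i u ≡ iterate fM (u ∷ []) i
f^≡iterate i u = trans (f^≡fold i) (iterate-is-fold (u ∷ []) fM i)
  where
  f^≡fold : ∀ i → f^ i u ≡ fold (u ∷ []) fM i
  f^≡fold zero = refl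
  f^≡fold (suc i) = cong fM (f^≡fold i)

corollary3p11 : (ℓ : ℕ) → 1 ≤ ℓ → (u w : Word) →
    binomW (φ^ ℓ w) u
      ≡ Σ< ℓ (λ i → Σ∈ (f^ i u) (λ v → binomN (length (φ^ (ℓ ∸ i ∸ 1) w)) (length v)))
        + Σ∈ (f^ ℓ u) (λ x → binomW w x)
corollary3p11 ℓ _ u w = begin
    binomW (φ^ ℓ w) u
  ≡⟨ sym (+-identityʳ _) ⟩
    ∑ (binomW (φ^ ℓ w)) (u ∷ [])
  ≡⟨ ∑-binomW-φ^ ℓ w (u ∷ []) ⟩
    Σ< ℓ (λ i → ∑ (λ v → binomN (length (φ^ (ℓ ∸ i ∸ 1) w)) (length v)) (iterate fM (u ∷ []) i))
      + ∑ (binomW w) (iterate fM (u ∷ []) ℓ)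
  ≡⟨ sym (cong₂ _+_ (∑-cong (λ i → Σ∈-f^ i _) (upTo ℓ)) (Σ∈-f^ ℓ (binomW w))) ⟩
    Σ< ℓ (λ i → Σ∈ (f^ i u) (λ v → binomN (length (φ^ (ℓ ∸ i ∸ 1) w)) (length v)))
      + Σ∈ (f^ ℓ u) (λ x → binomW w x)
  ∎
  where
  open ≡-Reasoning
  Σ∈-f^ : ∀ i g → Σ∈ (f^ i u) g ≡ ∑ g (iterate fM (u ∷ []) i)
  Σ∈-f^ i g = trans (Σ∈-∑ (f^ i u) g) (cong (∑ g) (f^≡iterate i u))
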